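{- Let $a>1$ be odd, $k=2a$, and $n=(2a+2)\left\lfloor\frac{a-1}{4}\right\rfloor$. Define $f:\{0,1,\ldots,n-1\}\to\{ -1,1\}$ by $f(j)=-1$ if $j\bmod a<\frac{a-1}{2}$ and $f(j)=1$ if $j\bmod a\ge\frac{a-1}{2}$ (where $j\bmod a\in\{0,\ldots,a-1\}$). Let $A\subseteq\{0,1,\ldots,n-1\}$ be any $k$-term arithmetic progression with positive common difference $d$. Then $\sum_{j\in A}f(j)\ne0$, and moreover $\left|\sum_{j\in A}f(j)\right|\ge\gcd(d,k)$. -}

module Defs where

open import Data.Nat using (ℕ; zero; suc; _+_; _*_; _∸_; _<ᵇ_; NonZero)
open import Data.Nat.DivMod using (_/_; _%_)
open import Data.Bool using (if_then_else_)
open import Data.Integer as ℤ using (ℤ)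

f : (a : ℕ) .{{_ : NonZero a}} → ℕ → ℤ
f a j = if (j % a) <ᵇ ((a ∸ 1) / 2) then ℤ.-1ℤ else ℤ.1ℤ

nLen : ℕ → ℕ
nLen a = (2 * a + 2) * ((a ∸ 1) / 4)

sumTo : ℕ → (ℕ → ℤ) → ℤ
sumTo zero    g = ℤ.0ℤ
sumTo (suc m) g = sumTo m g ℤ.+ g m

apSum : (a : ℕ) .{{_ : NonZero a}} → ℕ → ℕ → ℤ
apSum a s d = sumTo (2 * a) (λ i → f a (s + i * d))

module Submission where

open import Defs
open import Data.Nat using (ℕ; _+_; _*_; _∸_; _<_; _≤_; NonZero)
open import Data.Nat.DivMod using (_%_)
open import Data.Nat.GCD using (gcd)
open import Data.Integer as ℤ using (ℤ; ∣_∣)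
open import Data.Product using (_×_)
open import Relation.Binary.PropositionalEquality using (_≡_; _≢_)

open import Data.Nat as ℕ using (zero; suc; _<ᵇ_)
import Data.Nat.Properties as ℕP
open import Data.Nat.DivMod using (%-remove-+ʳ)
open import Data.Nat.Divisibility using (_∣_; divides; ∣⇒≤; ∣-trans; m∣m*n; n∣m*n; *-monoʳ-∣; n∣m⇒m%n≡0)
open import Data.Nat.GCD using (gcd[m,n]∣m; gcd[m,n]∣n; gcd[m,n]≢0; gcd-greatest; c*gcd[m,n]≡gcd[cm,cn])
open import Data.Nat.Tactic.RingSolver using () renaming (solve-∀ to ℕ-solve-∀)
import Data.Integer.Properties as ℤP
open import Data.Integer.Tactic.RingSolver using (solve-∀)
open import Data.Product using (_,_; ∃)
open import Data.Sum using (_⊎_; inj₁; inj₂)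
open import Data.Bool using (true; false; if_then_else_)
open import Relation.Binary.PropositionalEquality using (refl; sym; trans; cong; cong₂; subst; module ≡-Reasoning)

-- Let g = gcd(d, a) and a = q g. Since a ∣ q d, the terms of the progression repeat
-- modulo a with period q, so the sum over the k = 2a = 2g·q terms is 2g times the
-- sum V over one period. V is a sum of q values ±1 and q divides the odd number a,
-- so V is odd, in particular nonzero. Hence |Σ f| = 2g|V| is a nonzero multiple of
-- 2g, which is a multiple of gcd(d, 2a).

IsSign : ℤ → Set
IsSign x = x ≡ ℤ.1ℤ ⊎ x ≡ ℤ.-1ℤ

sumTo-cong : ∀ m {g h : ℕ → ℤ} → (∀ i → g i ≡ h i) → sumTo m g ≡ sumTo m h
sumTo-cong zero    g≗h = refl
sumTo-cong (suc m) g≗h = cong₂ ℤ._+_ (sumTo-cong m g≗h) (g≗h m)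

sumTo-+ : ∀ m n (h : ℕ → ℤ) → sumTo (m + n) h ≡ sumTo m h ℤ.+ sumTo n (λ i → h (m + i))
sumTo-+ m zero    h rewrite ℕP.+-identityʳ m = sym (ℤP.+-identityʳ _)
sumTo-+ m (suc n) h rewrite ℕP.+-suc m n | sumTo-+ m n h = ℤP.+-assoc (sumTo m h) _ _

sumTo-periodic : ∀ c p (h : ℕ → ℤ) → (∀ i → h (p + i) ≡ h i) →
                 sumTo (c * p) h ≡ ℤ.+ c ℤ.* sumTo p h
sumTo-periodic zero    p h periodic = refl
sumTo-periodic (suc c) p h periodic = begin
  sumTo (p + c * p) h                            ≡⟨ sumTo-+ p (c * p) h ⟩
  sumTo p h ℤ.+ sumTo (c * p) (λ i → h (p + i))  ≡⟨ cong (λ x → sumTo p h ℤ.+ x) (sumTo-cong (c * p) periodic) ⟩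
  sumTo p h ℤ.+ sumTo (c * p) h                  ≡⟨ cong (λ x → sumTo p h ℤ.+ x) (sumTo-periodic c p h periodic) ⟩
  sumTo p h ℤ.+ ℤ.+ c ℤ.* sumTo p h              ≡⟨ distrib (sumTo p h) (ℤ.+ c) ⟩
  ℤ.+ (suc c) ℤ.* sumTo p h                      ∎
  where
  open ≡-Reasoning
  distrib : ∀ x y → x ℤ.+ y ℤ.* x ≡ (ℤ.1ℤ ℤ.+ y) ℤ.* x
  distrib = solve-∀

-- c counts the terms equal to -1.
sumTo-signs-parity : ∀ m {h : ℕ → ℤ} → (∀ i → IsSign (h i)) →
                     ∃ λ c → sumTo m h ℤ.+ ℤ.+ (c * 2) ≡ ℤ.+ m
sumTo-signs-parity zero    signs = 0 , refl
sumTo-signs-parity (suc m) {h} signs with sumTo-signs-parity m signs | signs m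
... | c , sum+2c≡m | inj₁ hm≡1 = c , (begin
  sumTo m h ℤ.+ h m ℤ.+ ℤ.+ (c * 2)       ≡⟨ cong (λ y → sumTo m h ℤ.+ y ℤ.+ ℤ.+ (c * 2)) hm≡1 ⟩
  sumTo m h ℤ.+ ℤ.1ℤ ℤ.+ ℤ.+ (c * 2)      ≡⟨ shift (sumTo m h) (ℤ.+ (c * 2)) ⟩
  ℤ.1ℤ ℤ.+ (sumTo m h ℤ.+ ℤ.+ (c * 2))    ≡⟨ cong (λ x → ℤ.1ℤ ℤ.+ x) sum+2c≡m ⟩
  ℤ.+ suc m                               ∎)
  where
  open ≡-Reasoning
  shift : ∀ x y → x ℤ.+ ℤ.1ℤ ℤ.+ y ≡ ℤ.1ℤ ℤ.+ (x ℤ.+ y)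
  shift = solve-∀
... | c , sum+2c≡m | inj₂ hm≡-1 = suc c , (begin
  sumTo m h ℤ.+ h m ℤ.+ ℤ.+ (suc c * 2)                 ≡⟨ cong (λ y → sumTo m h ℤ.+ y ℤ.+ ℤ.+ (suc c * 2)) hm≡-1 ⟩
  sumTo m h ℤ.+ ℤ.-1ℤ ℤ.+ (ℤ.+ 2 ℤ.+ ℤ.+ (c * 2))       ≡⟨ shift (sumTo m h) (ℤ.+ (c * 2)) ⟩
  ℤ.1ℤ ℤ.+ (sumTo m h ℤ.+ ℤ.+ (c * 2))                  ≡⟨ cong (λ x → ℤ.1ℤ ℤ.+ x) sum+2c≡m ⟩
  ℤ.+ suc m                                             ∎)
  where
  open ≡-Reasoning
  shift : ∀ x y → x ℤ.+ ℤ.-1ℤ ℤ.+ (ℤ.+ 2 ℤ.+ y) ≡ ℤ.1ℤ ℤ.+ (x ℤ.+ y)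
  shift = solve-∀

sumTo-signs≡0⇒2∣ : ∀ m {h : ℕ → ℤ} → (∀ i → IsSign (h i)) → sumTo m h ≡ ℤ.0ℤ → 2 ∣ m
sumTo-signs≡0⇒2∣ m signs sum≡0 with sumTo-signs-parity m signs
... | c , sum+2c≡m = divides c (sym (ℤP.+-injective (trans (cong (λ x → x ℤ.+ ℤ.+ (c * 2)) (sym sum≡0)) sum+2c≡m)))

f-isSign : ∀ a .{{_ : NonZero a}} j → IsSign (f a j)
f-isSign a j with (j % a) <ᵇ ((a ∸ 1) ℕ./ 2)
... | true  = inj₂ refl
... | false = inj₁ refl

f-cong-% : ∀ a .{{_ : NonZero a}} {j j′} → j % a ≡ j′ % a → f a j ≡ f a j′
f-cong-% a j≡j′ = cong (λ r → if r <ᵇ ((a ∸ 1) ℕ./ 2) then ℤ.-1ℤ else ℤ.1ℤ) j≡j′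

f-ap-periodic : ∀ a .{{_ : NonZero a}} s d q i → a ∣ q * d →
                f a (s + (q + i) * d) ≡ f a (s + i * d)
f-ap-periodic a s d q i a∣qd = f-cong-% a (begin
  (s + (q + i) * d) % a      ≡⟨ cong (_% a) (shift s d q i) ⟩
  (s + i * d + q * d) % a    ≡⟨ %-remove-+ʳ (s + i * d) a∣qd ⟩
  (s + i * d) % a            ∎)
  where
  open ≡-Reasoning
  shift : ∀ s d q i → s + (q + i) * d ≡ s + i * d + q * d
  shift = ℕ-solve-∀

apSum-factor : ∀ a .{{_ : NonZero a}} s d {q g} → a ≡ q * g → g ∣ d →
               apSum a s d ≡ ℤ.+ (2 * g) ℤ.* sumTo q (λ i → f a (s + i * d))
apSum-factor a s d {q} {g} a≡qg g∣d = begin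
  sumTo (2 * a) h          ≡⟨ cong (λ m → sumTo m h) (trans (cong (2 *_) a≡qg) (regroup q g)) ⟩
  sumTo (2 * g * q) h      ≡⟨ sumTo-periodic (2 * g) q h (λ i → f-ap-periodic a s d q i a∣qd) ⟩
  ℤ.+ (2 * g) ℤ.* sumTo q h ∎
  where
  open ≡-Reasoning
  h : ℕ → ℤ
  h i = f a (s + i * d)
  regroup : ∀ q g → 2 * (q * g) ≡ 2 * g * q
  regroup = ℕ-solve-∀
  a∣qd : a ∣ q * d
  a∣qd = subst (_∣ q * d) (sym a≡qg) (*-monoʳ-∣ q g∣d)

gcd[m,cn]∣c*gcd[m,n] : ∀ c m n → gcd m (c * n) ∣ c * gcd m n
gcd[m,cn]∣c*gcd[m,n] c m n = subst (gcd m (c * n) ∣_) (sym (c*gcd[m,n]≡gcd[cm,cn] c m n))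
  (gcd-greatest (∣-trans (gcd[m,n]∣m m (c * n)) (n∣m*n c)) (gcd[m,n]∣n m (c * n)))

theorem3p6 : (a : ℕ) .{{_ : NonZero a}} → 1 < a → a % 2 ≡ 1 →
    (s d : ℕ) → 0 < d → s + (2 * a ∸ 1) * d < nLen a →
    (apSum a s d ≢ ℤ.0ℤ) × (gcd d (2 * a) ≤ ∣ apSum a s d ∣)
theorem3p6 a _ a-odd s d _ _ with gcd[m,n]∣n d a
... | divides q a≡qg = apSum≢0 , ∣⇒≤ gcd∣∣apSum∣
  where
  g : ℕ
  g = gcd d a
  V : ℤ
  V = sumTo q (λ i → f a (s + i * d))

  apSum≡2gV : apSum a s d ≡ ℤ.+ (2 * g) ℤ.* V
  apSum≡2gV = apSum-factor a s d {q} a≡qg (gcd[m,n]∣m d a)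

  V≢0 : V ≢ ℤ.0ℤ
  V≢0 V≡0 = ℕP.1+n≢0 (trans (sym a-odd) (n∣m⇒m%n≡0 a 2 2∣a))
    where
    2∣a : 2 ∣ a
    2∣a = ∣-trans (sumTo-signs≡0⇒2∣ q (λ i → f-isSign a _) V≡0)
                  (subst (q ∣_) (sym a≡qg) (m∣m*n g))

  instance
    g-nonZero : NonZero g
    g-nonZero = ℕ.≢-nonZero (gcd[m,n]≢0 d a (inj₂ (ℕ.≢-nonZero⁻¹ a)))
    2g-nonZero : NonZero (2 * g)
    2g-nonZero = ℕP.m*n≢0 2 g
    V-nonZero : ℤ.NonZero V
    V-nonZero = ℤ.≢-nonZero V≢0
    apSum-nonZero : ℤ.NonZero (apSum a s d)
    apSum-nonZero = subst ℤ.NonZero (sym apSum≡2gV) (ℤP.i*j≢0 (ℤ.+ (2 * g)) V)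

  apSum≢0 : apSum a s d ≢ ℤ.0ℤ
  apSum≢0 apSum≡0 = ℕ.≢-nonZero⁻¹ ∣ apSum a s d ∣ (cong ∣_∣ apSum≡0)

  gcd∣∣apSum∣ : gcd d (2 * a) ∣ ∣ apSum a s d ∣
  gcd∣∣apSum∣ = subst (gcd d (2 * a) ∣_) (sym (trans (cong ∣_∣ apSum≡2gV) (ℤP.abs-* (ℤ.+ (2 * g)) V)))
                      (∣-trans (gcd[m,cn]∣c*gcd[m,n] 2 d a) (m∣m*n ∣ V ∣))
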